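{- Let $k \ge 3$, let $G$ be a $k$-Ore graph and let $v \in V(G)$. Then $G - v$ contains a subgraph isomorphic to $K_{k-1}$.
   Context: Ore composition of graphs $H_1,H_2$: delete an edge $xy$ of $H_1$; split a vertex $z$ of $H_2$ into two vertices $z_1,z_2$ of positive degree with $N(z_1)\cup N(z_2)=N(z)$ and $N(z_1)\cap N(z_2)=\emptyset$; identify $x$ with $z_1$ and $y$ with $z_2$. A graph is $k$-Ore if it is $K_k$ or an Ore composition of two $k$-Ore graphs. -}

module Defs where

open import Data.Nat using (ℕ)
open import Data.Fin using (Fin)
open import Data.Bool using (Bool; true; false)
open import Data.Product using (Σ; ∃; _×_; _,_)
open import Data.Sum using (_⊎_; inj₁; inj₂)
open import Data.Empty using (⊥)
open import Relation.Nullary using (¬_)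
open import Relation.Binary.PropositionalEquality using (_≡_; _≢_; refl; sym)

record Graph : Set₁ where
  field
    V      : Set
    E      : V → V → Set
    E-sym  : ∀ {u v} → E u v → E v u
    E-irr  : ∀ {v} → ¬ E v v
open Graph public

K : ℕ → Graph
K k = record { V = Fin k ; E = λ u v → u ≢ v
             ; E-sym = λ p q → p (sym q) ; E-irr = λ p → p refl }

record Iso (G H : Graph) : Set where
  field
    to     : V G → V H
    from   : V H → V G
    from-to : ∀ v → from (to v) ≡ v
    to-from : ∀ w → to (from w) ≡ w
    E-to   : ∀ {u v} → E G u v → E H (to u) (to v)
    E-from : ∀ {u v} → E H (to u) (to v) → E G u v

-- Data for an Ore composition of H₁ and H₂: an edge xy of H₁, a vertex z
-- of H₂, and a split of N(z) into N(z₁) = {w ∈ N(z) | side w ≡ true} and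
-- N(z₂) = {w ∈ N(z) | side w ≡ false}, both nonempty (positive degree).
record OreData (H₁ H₂ : Graph) : Set where
  field
    x y   : V H₁
    xy    : E H₁ x y
    z     : V H₂
    side  : V H₂ → Bool
    deg₁  : ∃ λ w → E H₂ z w × side w ≡ true
    deg₂  : ∃ λ w → E H₂ z w × side w ≡ false

module _ {H₁ H₂ : Graph} (d : OreData H₁ H₂) where
  open OreData d

  -- vertex set: V(H₁) ⊔ (V(H₂) ∖ {z}); x plays z₁, y plays z₂.
  OreV : Set
  OreV = V H₁ ⊎ Σ (V H₂) (λ w → w ≢ z)

  SplitE : V H₁ → V H₂ → Set
  SplitE a b = (a ≡ x × E H₂ z b × side b ≡ true)
             ⊎ (a ≡ y × E H₂ z b × side b ≡ false)

  OreE : OreV → OreV → Set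
  OreE (inj₁ a) (inj₁ b) =
    E H₁ a b × ¬ ((a ≡ x × b ≡ y) ⊎ (a ≡ y × b ≡ x))
  OreE (inj₂ (a , _)) (inj₂ (b , _)) = E H₂ a b
  OreE (inj₁ a) (inj₂ (b , _)) = SplitE a b
  OreE (inj₂ (a , _)) (inj₁ b) = SplitE b a

  private
    swap : ∀ {a b} → (a ≡ x × b ≡ y) ⊎ (a ≡ y × b ≡ x)
                   → (b ≡ x × a ≡ y) ⊎ (b ≡ y × a ≡ x)
    swap (inj₁ (p , q)) = inj₂ (q , p)
    swap (inj₂ (p , q)) = inj₁ (q , p)

    OreE-sym : ∀ {u v} → OreE u v → OreE v u
    OreE-sym {inj₁ a} {inj₁ b} (e , n) = E-sym H₁ e , λ s → n (swap s)
    OreE-sym {inj₁ a} {inj₂ _} e = e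
    OreE-sym {inj₂ _} {inj₁ b} e = e
    OreE-sym {inj₂ _} {inj₂ _} e = E-sym H₂ e

    OreE-irr : ∀ {v} → ¬ OreE v v
    OreE-irr {inj₁ a} (e , _) = E-irr H₁ e
    OreE-irr {inj₂ _} e = E-irr H₂ e

  oreCompose : Graph
  oreCompose = record { V = OreV ; E = OreE ; E-sym = λ {u} {v} → OreE-sym {u} {v} ; E-irr = λ {v} → OreE-irr {v} }

data KOre (k : ℕ) : Graph → Set₁ where
  base : ∀ {G} → Iso (K k) G → KOre k G
  ore  : ∀ {H₁ H₂ G} → KOre k H₁ → KOre k H₂
       → (d : OreData H₁ H₂) → Iso (oreCompose d) G → KOre k G

ContainsKminus : (G : Graph) → V G → ℕ → Set
ContainsKminus G v m =
  Σ (Fin m → V G) λ f →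
    (∀ i j → f i ≡ f j → i ≡ j) ×
    (∀ i → f i ≢ v) ×
    (∀ i j → i ≢ j → E G (f i) (f j))

module Submission where

-- An Ore composition keeps H₂ − z intact and keeps every edge of H₁ − x
-- (the deleted edge xy meets x). So for a vertex on the H₁ side, a K_{k−1}
-- of H₂ − z (by induction) survives and avoids it; for a vertex on the H₂
-- side, a K_{k−1} of H₁ − x does.

open import Defs
open import Data.Nat using (ℕ; _≥_; _∸_; suc)
open import Data.Fin using (Fin; punchIn)
open import Data.Fin.Properties using (punchIn-injective; punchInᵢ≢i)
open import Data.Product using (Σ; _,_; proj₁)
open import Data.Sum using (inj₁; inj₂)
open import Data.Sum.Properties using (inj₁-injective; inj₂-injective)
open import Relation.Binary.PropositionalEquality

ContainsKminus-embed : ∀ {A B : Graph} {a : V A} {b : V B} {m} →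
  (g : (u : V A) → u ≢ a → V B) →
  (∀ {u u′} p p′ → g u p ≡ g u′ p′ → u ≡ u′) →
  (∀ u p → g u p ≢ b) →
  (∀ {u u′} p p′ → E A u u′ → E B (g u p) (g u′ p′)) →
  ContainsKminus A a m → ContainsKminus B b m
ContainsKminus-embed g g-inj g-avoids g-edge (f , f-inj , f-avoids , f-edge) =
  (λ i → g (f i) (f-avoids i)) ,
  (λ i j eq → f-inj i j (g-inj (f-avoids i) (f-avoids j) eq)) ,
  (λ i → g-avoids (f i) (f-avoids i)) ,
  (λ i j i≢j → g-edge (f-avoids i) (f-avoids j) (f-edge i j i≢j))

ContainsKminus-iso : ∀ {A B : Graph} (I : Iso A B) (v : V B) {m} →
  ContainsKminus A (Iso.from I v) m → ContainsKminus B v m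
ContainsKminus-iso {A} {B} I v =
  ContainsKminus-embed {A} {B} (λ u _ → to u) to-injective to-avoids (λ _ _ → E-to)
  where
  open Iso I
  to-injective : ∀ {u u′} p p′ → to u ≡ to u′ → u ≡ u′
  to-injective {u} {u′} _ _ eq =
    trans (sym (from-to u)) (trans (cong from eq) (from-to u′))
  to-avoids : ∀ u → u ≢ from v → to u ≢ v
  to-avoids u u≢ eq = u≢ (trans (sym (from-to u)) (cong from eq))

K-minus-vertex : ∀ k (w : Fin k) → ContainsKminus (K k) w (k ∸ 1)
K-minus-vertex (suc n) w =
  punchIn w ,
  punchIn-injective w ,
  punchInᵢ≢i w ,
  (λ i j i≢j eq → i≢j (punchIn-injective w i j eq))

module _ {H₁ H₂ : Graph} (d : OreData H₁ H₂) where
  open OreData d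

  ContainsKminus-oreˡ : ∀ {m} (a : V H₁) →
    ContainsKminus H₂ z m → ContainsKminus (oreCompose d) (inj₁ a) m
  ContainsKminus-oreˡ a = ContainsKminus-embed {H₂} {oreCompose d}
    (λ u u≢z → inj₂ (u , u≢z))
    (λ _ _ eq → cong proj₁ (inj₂-injective eq))
    (λ _ _ ())
    (λ _ _ e → e)

  ContainsKminus-oreʳ : ∀ {m} (b : Σ (V H₂) (_≢ z)) →
    ContainsKminus H₁ x m → ContainsKminus (oreCompose d) (inj₂ b) m
  ContainsKminus-oreʳ b = ContainsKminus-embed {H₁} {oreCompose d}
    (λ u _ → inj₁ u)
    (λ _ _ → inj₁-injective)
    (λ _ _ ())
    (λ u≢x u′≢x e → e , λ { (inj₁ (u≡x , _)) → u≢x u≡x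
                          ; (inj₂ (_ , u′≡x)) → u′≢x u′≡x })

KOre⇒ContainsKminus : ∀ {k G} → KOre k G → (v : V G) →
  ContainsKminus G v (k ∸ 1)
KOre⇒ContainsKminus {k} (base I) v =
  ContainsKminus-iso I v (K-minus-vertex k (Iso.from I v))
KOre⇒ContainsKminus {k} (ore h₁ h₂ d I) v =
  ContainsKminus-iso I v (clique-avoiding (Iso.from I v))
  where
  open OreData d
  clique-avoiding : (u : OreV d) → ContainsKminus (oreCompose d) u (k ∸ 1)
  clique-avoiding (inj₁ a) = ContainsKminus-oreˡ d a (KOre⇒ContainsKminus h₂ z)
  clique-avoiding (inj₂ b) = ContainsKminus-oreʳ d b (KOre⇒ContainsKminus h₁ x)

mainTheorem3 : (k : ℕ) → k ≥ 3 → (G : Graph) → KOre k G →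
    (v : V G) → ContainsKminus G v (k ∸ 1)
mainTheorem3 k _ G = KOre⇒ContainsKminus
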